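{- For all integers $1\le k\le n$, $\hat{E}_{k,n}(q)=\hat{E}_{n+1-k,n}(q)$.
   Context: Place $1,\dots,n$ clockwise on a circle. Distinct elements $a_1,\dots,a_r\in[n]$ are in clockwise cyclic order if some cyclic rotation of $(a_1,\dots,a_r)$ is strictly increasing. For $\pi\in S_n$, position $i$ is a weak excedence if $\pi(i)\ge i$. An unordered pair $\{i,j\}$ of distinct elements is an alignment of $\pi$ if for one of the two orderings $(i,j)$ either (a) $\pi(i)\ne i$, $\pi(j)\ne j$, and $i,\pi(i),\pi(j),j$ are four distinct elements in clockwise cyclic order, or (b) $\pi(i)=i$, $\pi(j)\ne j$, and $i,\pi(j),j$ are in clockwise cyclic order. $E_{k,n}(q)=\sum_\pi q^{k(n-k)-\mathrm{al}(\pi)}$ over $\pi\in S_n$ with exactly $k$ weak excedences, $\mathrm{al}(\pi)$ the number of alignments, and $\hat{E}_{k,n}(q)=q^{k-n}E_{k,n}(q)$. -}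

module Defs where

open import Data.Nat using (ℕ; zero; suc; _+_; _*_; _∸_; _<ᵇ_; _≡ᵇ_)
open import Data.Bool using (Bool; true; false; _∧_; _∨_; not; if_then_else_)
open import Data.Fin using (Fin; toℕ)
open import Data.Fin.Properties using (_≟_)
open import Data.List using (List; []; _∷_; _++_; map; concatMap; length; filterᵇ; allFin; upTo)
open import Data.Vec using (Vec; []; _∷_; lookup)
open import Data.Integer as ℤ using (ℤ; +_; _-_)
open import Relation.Nullary.Decidable using (⌊_⌋)

-- Elements of [n] are represented by Fin n (0,…,n-1 instead of 1,…,n; both
-- cyclic order and weak excedences are invariant under this shift).

allVecs : (n m : ℕ) → List (Vec (Fin n) m)
allVecs n zero = [] ∷ []
allVecs n (suc m) = concatMap (λ x → map (x ∷_) (allVecs n m)) (allFin n)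

anyᵇ : {A : Set} → (A → Bool) → List A → Bool
anyᵇ p [] = false
anyᵇ p (x ∷ xs) = p x ∨ anyᵇ p xs

allᵇ : {A : Set} → (A → Bool) → List A → Bool
allᵇ p [] = true
allᵇ p (x ∷ xs) = p x ∧ allᵇ p xs

isPerm : {n : ℕ} → Vec (Fin n) n → Bool
isPerm {n} π = allᵇ (λ i → allᵇ (λ j → ⌊ i ≟ j ⌋ ∨ not ⌊ lookup π i ≟ lookup π j ⌋) (allFin n)) (allFin n)

Sym : (n : ℕ) → List (Vec (Fin n) n)
Sym n = filterᵇ isPerm (allVecs n n)

increasing : List ℕ → Bool
increasing [] = true
increasing (x ∷ []) = true
increasing (x ∷ y ∷ xs) = (x <ᵇ y) ∧ increasing (y ∷ xs)

rot : List ℕ → List ℕ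
rot [] = []
rot (x ∷ xs) = xs ++ (x ∷ [])

rotations : List ℕ → List (List ℕ)
rotations xs = go (length xs) xs
  where
  go : ℕ → List ℕ → List (List ℕ)
  go zero ys = []
  go (suc m) ys = ys ∷ go m (rot ys)

-- a_1,…,a_r are in clockwise cyclic order: some cyclic rotation is strictly
-- increasing (this forces the a_i to be distinct)
clockwise : List ℕ → Bool
clockwise xs = anyᵇ increasing (rotations xs)

wex : {n : ℕ} → Vec (Fin n) n → ℕ
wex {n} π = length (filterᵇ (λ i → not (toℕ (lookup π i) <ᵇ toℕ i)) (allFin n))

alignedOrd : {n : ℕ} → Vec (Fin n) n → Fin n → Fin n → Bool
alignedOrd π i j =
  let a = toℕ i ; b = toℕ (lookup π i) ; c = toℕ (lookup π j) ; d = toℕ j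
      fi = a ≡ᵇ b ; fj = d ≡ᵇ c
  in (not fi ∧ not fj ∧ clockwise (a ∷ b ∷ c ∷ d ∷ []))
     ∨ (fi ∧ not fj ∧ clockwise (a ∷ c ∷ d ∷ []))

-- number of alignments: unordered pairs {i,j} (counted once, as i < j)
-- such that one of the two orderings satisfies the condition
al : {n : ℕ} → Vec (Fin n) n → ℕ
al {n} π = length (concatMap (λ i →
  filterᵇ (λ j → (toℕ i <ᵇ toℕ j) ∧ (alignedOrd π i j ∨ alignedOrd π j i)) (allFin n))
  (allFin n))

-- exponent of q contributed by π to Ê_{k,n}(q) = q^{k-n} E_{k,n}(q):
-- (k - n) + (k(n-k) - al(π)), as an integer
hatExp : (k n : ℕ) → Vec (Fin n) n → ℤ
hatExp k n π = ((+ k) - (+ n)) ℤ.+ ((+ (k * (n ∸ k))) - (+ al π))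

-- coefficient of q^e in the Laurent polynomial Ê_{k,n}(q)
hatE-coeff : (k n : ℕ) → ℤ → ℕ
hatE-coeff k n e =
  length (filterᵇ (λ π → (wex π ≡ᵇ k) ∧ ⌊ hatExp k n π ℤ.≟ e ⌋) (Sym n))

{-# OPTIONS --safe #-}
module Submission where

-- The involution dual π = opposite ∘ π ∘ negate, i.e. i ↦ n − 1 − π(−i mod n) on 0-based
-- values, exchanges the coefficients of Ê_{k,n} and Ê_{n+1−k,n}.
-- Position −i of dual π is a weak excedence exactly when i = 0 or π(i) < i, so dual sends
-- the number w of weak excedences to n + 1 − w.
-- Put position i at 2i and value π(i) at 2π(i) + 1 on a circle of 2n points. Then both
-- kinds of alignment of (i, j) say that 2i, 2π(i) + 1, 2π(j) + 1, 2j are in clockwise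
-- order, and dual acts on the circle by the reflection x ↦ −x, which reverses cyclic order;
-- hence dual preserves alignments. Finally k − n + k(n − k) is invariant under k ↦ n + 1 − k.

open import Defs
open import Data.Nat using (ℕ; _≤_; _+_; _∸_)
open import Data.Integer using (ℤ)
open import Relation.Binary.PropositionalEquality using (_≡_)

open import Algebra.Definitions using (Involutive)
open import Data.Bool using (Bool; true; false; _∧_; _∨_; not; T)
open import Data.Bool.Properties using (∨-comm; ∨-identityʳ; T-≡; T-∧)
open import Data.Empty using (⊥; ⊥-elim)
open import Data.Fin using (Fin; zero; suc; toℕ; opposite)
open import Data.Fin.Properties using (_≟_; toℕ<n; toℕ-injective; opposite-prop; opposite-involutive)
open import Data.Integer as ℤ using (+_; _-_)
import Data.Integer.Properties as ℤ
open import Data.Integer.Solver using (module +-*-Solver)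
open import Data.List
  using (List; []; _∷_; _++_; map; concatMap; length; filterᵇ; allFin; cartesianProduct; cartesianProductWith)
open import Data.List.Properties using (length-++; filter-++; map-tabulate; length-tabulate)
open import Data.List.Membership.Propositional using (_∈_)
open import Data.List.Membership.Propositional.Properties
  using (∈-map⁺; ∈-map⁻; ∈-allFin; ∈-filter⁺; ∈-filter⁻; ∈-cartesianProductWith⁺; ∈-cartesianProduct⁺)
open import Data.List.Membership.Propositional.Properties.WithK using (unique∧set⇒bag)
open import Data.List.Relation.Binary.BagAndSetEquality using (∼bag⇒↭)
open import Data.List.Relation.Binary.Permutation.Propositional using (_↭_)
open import Data.List.Relation.Binary.Permutation.Propositional.Properties using (filter-↭; ↭-length)
open import Data.List.Relation.Unary.Any using (here; there)
import Data.List.Relation.Unary.All as All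
import Data.List.Relation.Unary.AllPairs as AllPairs
open import Data.List.Relation.Unary.Unique.Propositional using (Unique)
import Data.List.Relation.Unary.Unique.Propositional.Properties as Unique
open import Data.Nat using (zero; suc; _*_; _<ᵇ_; _≡ᵇ_; _<_; s≤s; s≤s⁻¹; ⌊_/2⌋)
open import Data.Nat.Properties hiding (_≟_)
open import Data.Product using (_×_; _,_; proj₁; proj₂; uncurry; swap)
import Data.Product as Product
open import Data.Vec using (Vec; []; _∷_; lookup; tabulate)
open import Data.Vec.Properties using (∷-injective; lookup∘tabulate; tabulate-cong; tabulate∘lookup)
open import Function using (_∘_; id; Equivalence; mk⇔)
open import Function.Definitions using (Injective)
open import Function.Consequences.Propositional using (inverseʳ⇒injective; strictlyInverseʳ⇒inverseʳ)
open import Relation.Nullary using (¬_; yes; no)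
open import Relation.Nullary.Decidable using (T?; ⌊_⌋)
open import Relation.Binary.PropositionalEquality
  using (_≢_; refl; sym; trans; cong; cong₂; subst; module ≡-Reasoning)

T-ext : {a b : Bool} → (T a → T b) → (T b → T a) → a ≡ b
T-ext {false} {false} _   _   = refl
T-ext {false} {true}  _   b⇒a = ⊥-elim (b⇒a _)
T-ext {true}  {false} a⇒b _   = ⊥-elim (a⇒b _)
T-ext {true}  {true}  _   _   = refl

<ᵇ-cong : ∀ {m n m′ n′} → (m < n → m′ < n′) → (m′ < n′ → m < n) →
          (m <ᵇ n) ≡ (m′ <ᵇ n′)
<ᵇ-cong {m} {n} {m′} {n′} to from =
  T-ext (<⇒<ᵇ ∘ to ∘ <ᵇ⇒< m n) (<⇒<ᵇ ∘ from ∘ <ᵇ⇒< m′ n′)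

n<ᵇn : ∀ n → (n <ᵇ n) ≡ false
n<ᵇn zero    = refl
n<ᵇn (suc n) = n<ᵇn n

n<ᵇ1+n : ∀ n → (n <ᵇ suc n) ≡ true
n<ᵇ1+n zero    = refl
n<ᵇ1+n (suc n) = n<ᵇ1+n n

not-<ᵇ : ∀ m n → not (m <ᵇ n) ≡ (n <ᵇ suc m)
not-<ᵇ m       zero    = refl
not-<ᵇ zero    (suc n) = refl
not-<ᵇ (suc m) (suc n) = not-<ᵇ m n

m≢n⇒m<ᵇ1+n : ∀ {m n} → m ≢ n → (m <ᵇ suc n) ≡ (m <ᵇ n)
m≢n⇒m<ᵇ1+n m≢n = <ᵇ-cong (λ m<1+n → ≤∧≢⇒< (s≤s⁻¹ m<1+n) m≢n) m<n⇒m<1+n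

∸-<ᵇ-flip : ∀ {N x y} → x ≤ N → (N ∸ x <ᵇ N ∸ y) ≡ (y <ᵇ x)
∸-<ᵇ-flip {N} x≤N = <ᵇ-cong
  (λ N∸x<N∸y → ≰⇒> (λ x≤y → <⇒≱ N∸x<N∸y (∸-monoʳ-≤ N x≤y)))
  (λ y<x → ∸-monoʳ-< y<x x≤N)

2*<ᵇ2* : ∀ x y → (2 * x <ᵇ 2 * y) ≡ (x <ᵇ y)
2*<ᵇ2* x y = <ᵇ-cong (*-cancelˡ-< 2 x y) (*-monoʳ-< 2)

2*<ᵇ1+2* : ∀ x y → (2 * x <ᵇ suc (2 * y)) ≡ (x <ᵇ suc y)
2*<ᵇ1+2* x y = <ᵇ-cong {m′ = x}
  (λ 2x<1+2y → s≤s (*-cancelˡ-≤ 2 (s≤s⁻¹ 2x<1+2y)))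
  (λ x<1+y → s≤s (*-monoʳ-≤ 2 (s≤s⁻¹ x<1+y)))

1+2*<ᵇ2* : ∀ x y → (suc (2 * x) <ᵇ 2 * y) ≡ (x <ᵇ y)
1+2*<ᵇ2* x y = <ᵇ-cong
  (λ 1+2x<2y → *-cancelˡ-< 2 x y (<-trans (n<1+n _) 1+2x<2y))
  (λ x<y → subst (_≤ 2 * y) (*-suc 2 x) (*-monoʳ-≤ 2 x<y))

m+m≡n+n⇒m≡n : ∀ {m n} → m + m ≡ n + n → m ≡ n
m+m≡n+n⇒m≡n {m} {n} eq = trans (n≡⌊n+n/2⌋ m) (trans (cong ⌊_/2⌋ eq) (sym (n≡⌊n+n/2⌋ n)))

≡ᵇ-complement : ∀ a b {s} k → a + b ≡ s → k ≤ s → (a ≡ᵇ k) ≡ (b ≡ᵇ s ∸ k)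
≡ᵇ-complement a b {s} k a+b≡s k≤s = T-ext
  (λ a≡ᵇk → ≡⇒≡ᵇ b (s ∸ k) (sym (begin
    s ∸ k      ≡⟨ cong₂ _∸_ (sym a+b≡s) (sym (≡ᵇ⇒≡ a k a≡ᵇk)) ⟩
    a + b ∸ a  ≡⟨ m+n∸m≡n a b ⟩
    b          ∎)))
  (λ b≡ᵇs∸k → ≡⇒≡ᵇ a k (+-cancelʳ-≡ (s ∸ k) a k (begin
    a + (s ∸ k) ≡⟨ cong (_+_ a) (sym (≡ᵇ⇒≡ b (s ∸ k) b≡ᵇs∸k)) ⟩
    a + b       ≡⟨ a+b≡s ⟩
    s           ≡⟨ sym (m+[n∸m]≡n k≤s) ⟩
    k + (s ∸ k) ∎)))
  where open ≡-Reasoning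

involutive⇒injective : {A : Set} (h : A → A) → Involutive _≡_ h → Injective _≡_ _≡_ h
involutive⇒injective h h-inv = inverseʳ⇒injective h (strictlyInverseʳ⇒inverseʳ {f⁻¹ = h} h h-inv)

count : {A : Set} → (A → Bool) → List A → ℕ
count p xs = length (filterᵇ p xs)

module _ {A : Set} where

  count-cong : {p q : A → Bool} → (∀ x → p x ≡ q x) → ∀ xs → count p xs ≡ count q xs
  count-cong p≗q [] = refl
  count-cong {p} {q} p≗q (x ∷ xs) with p x | q x | p≗q x
  ... | true  | .true  | refl = cong suc (count-cong p≗q xs)
  ... | false | .false | refl = count-cong p≗q xs

  count-++ : (p : A → Bool) (xs ys : List A) → count p (xs ++ ys) ≡ count p xs + count p ys
  count-++ p xs ys = trans (cong length (filter-++ (T? ∘ p) xs ys)) (length-++ (filterᵇ p xs))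

  count-map : {B : Set} (p : B → Bool) (h : A → B) (xs : List A) → count p (map h xs) ≡ count (p ∘ h) xs
  count-map p h [] = refl
  count-map p h (x ∷ xs) with p (h x)
  ... | true  = cong suc (count-map p h xs)
  ... | false = count-map p h xs

  count-complement : (p : A → Bool) (xs : List A) → count (not ∘ p) xs + count p xs ≡ length xs
  count-complement p [] = refl
  count-complement p (x ∷ xs) with p x
  ... | true  = trans (+-suc _ _) (cong suc (count-complement p xs))
  ... | false = cong suc (count-complement p xs)

  count-∨ : (p q : A → Bool) → (∀ x → T (p x) → T (q x) → ⊥) → (xs : List A) →
            count (λ x → p x ∨ q x) xs ≡ count p xs + count q xs
  count-∨ p q disjoint [] = refl
  count-∨ p q disjoint (x ∷ xs) with p x in px | q x in qx
  ... | true  | true  = ⊥-elim (disjoint x (subst T (sym px) _) (subst T (sym qx) _))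
  ... | true  | false = cong suc (count-∨ p q disjoint xs)
  ... | false | true  = trans (cong suc (count-∨ p q disjoint xs)) (sym (+-suc _ _))
  ... | false | false = count-∨ p q disjoint xs

  map-involution-↭ : {h : A → A} {xs : List A} → Involutive _≡_ h → Unique xs →
                     (∀ {x} → x ∈ xs → h x ∈ xs) → map h xs ↭ xs
  map-involution-↭ {h} {xs} h-inv xs! closed =
    ∼bag⇒↭ (unique∧set⇒bag (Unique.map⁺ (involutive⇒injective h h-inv) xs!) xs! (mk⇔ to from))
    where
    to : ∀ {x} → x ∈ map h xs → x ∈ xs
    to x∈ with ∈-map⁻ h x∈
    ... | _ , y∈xs , refl = closed y∈xs
    from : ∀ {x} → x ∈ xs → x ∈ map h xs
    from {x} x∈xs = subst (_∈ map h xs) (h-inv x) (∈-map⁺ h (closed x∈xs))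

  count-involution : (p : A → Bool) {h : A → A} {xs : List A} → Involutive _≡_ h → Unique xs →
                     (∀ {x} → x ∈ xs → h x ∈ xs) → count (p ∘ h) xs ≡ count p xs
  count-involution p {h} {xs} h-inv xs! closed = trans (sym (count-map p h xs))
    (↭-length (filter-↭ (T? ∘ p) (map-involution-↭ h-inv xs! closed)))

concatMap-map : {A B C : Set} (f : A → B → C) (xs : List A) (ys : List B) →
                concatMap (λ x → map (f x) ys) xs ≡ cartesianProductWith f xs ys
concatMap-map f []       ys = refl
concatMap-map f (x ∷ xs) ys = cong (map (f x) ys ++_) (concatMap-map f xs ys)

length-concatMap-filterᵇ : {A B : Set} (p : A → B → Bool) (xs : List A) (ys : List B) →
  length (concatMap (λ x → filterᵇ (p x) ys) xs) ≡ count (uncurry p) (cartesianProduct xs ys)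
length-concatMap-filterᵇ p []       ys = refl
length-concatMap-filterᵇ p (x ∷ xs) ys = begin
  length (filterᵇ (p x) ys ++ concatMap (λ x → filterᵇ (p x) ys) xs)
    ≡⟨ length-++ (filterᵇ (p x) ys) ⟩
  count (p x) ys + length (concatMap (λ x → filterᵇ (p x) ys) xs)
    ≡⟨ cong₂ _+_ (sym (count-map (uncurry p) (x ,_) ys)) (length-concatMap-filterᵇ p xs ys) ⟩
  count (uncurry p) (map (x ,_) ys) + count (uncurry p) (cartesianProduct xs ys)
    ≡⟨ sym (count-++ (uncurry p) (map (x ,_) ys) _) ⟩
  count (uncurry p) (cartesianProduct (x ∷ xs) ys) ∎
  where open ≡-Reasoning

count-allFin-suc : ∀ {m} (p : Fin (suc m) → Bool) →
                   count p (allFin (suc m)) ≡ count p (zero ∷ []) + count (p ∘ suc) (allFin m)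
count-allFin-suc {m} p = begin
  count p (allFin (suc m))
    ≡⟨ cong (count p ∘ (zero ∷_)) (sym (map-tabulate id suc)) ⟩
  count p (zero ∷ map suc (allFin m))
    ≡⟨ count-++ p (zero ∷ []) _ ⟩
  count p (zero ∷ []) + count p (map suc (allFin m))
    ≡⟨ cong (_+_ (count p (zero ∷ []))) (count-map p suc (allFin m)) ⟩
  count p (zero ∷ []) + count (p ∘ suc) (allFin m) ∎
  where open ≡-Reasoning

allPairs : ∀ n → List (Fin n × Fin n)
allPairs n = cartesianProduct (allFin n) (allFin n)

count-allPairs-involution : ∀ {n} (p : Fin n × Fin n → Bool) {h} → Involutive _≡_ h →
                            count (p ∘ h) (allPairs n) ≡ count p (allPairs n)
count-allPairs-involution {n} p h-inv = count-involution p h-inv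
  (Unique.cartesianProduct⁺ (Unique.allFin⁺ n) (Unique.allFin⁺ n))
  (λ _ → ∈-cartesianProduct⁺ (∈-allFin _) (∈-allFin _))

allVecs-unique : ∀ n m → Unique (allVecs n m)
allVecs-unique n zero    = All.[] AllPairs.∷ AllPairs.[]
allVecs-unique n (suc m) = subst Unique (sym (concatMap-map _∷_ (allFin n) (allVecs n m)))
  (Unique.cartesianProductWith⁺ _∷_ ∷-injective (Unique.allFin⁺ n) (allVecs-unique n m))

∈-allVecs : ∀ {n m} (v : Vec (Fin n) m) → v ∈ allVecs n m
∈-allVecs []                  = here refl
∈-allVecs {n} {suc m} (x ∷ v) = subst (x ∷ v ∈_) (sym (concatMap-map _∷_ (allFin n) (allVecs n m)))
  (∈-cartesianProductWith⁺ _∷_ (∈-allFin x) (∈-allVecs v))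

module _ {A : Set} {p : A → Bool} where

  allᵇ⁻ : ∀ {xs} → T (allᵇ p xs) → ∀ {x} → x ∈ xs → T (p x)
  allᵇ⁻ {y ∷ xs} all (here refl)  = proj₁ (Equivalence.to T-∧ all)
  allᵇ⁻ {y ∷ xs} all (there x∈xs) = allᵇ⁻ (proj₂ (Equivalence.to T-∧ all)) x∈xs

  allᵇ⁺ : (∀ x → T (p x)) → ∀ xs → T (allᵇ p xs)
  allᵇ⁺ all []       = _
  allᵇ⁺ all (x ∷ xs) = Equivalence.from T-∧ (all x , allᵇ⁺ all xs)

module _ {n : ℕ} (π : Vec (Fin n) n) where

  isPerm⇒injective : T (isPerm π) → Injective _≡_ _≡_ (lookup π)
  isPerm⇒injective perm {i} {j} πi≡πj with allᵇ⁻ (allᵇ⁻ perm (∈-allFin i)) (∈-allFin j)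
  ... | distinct with i ≟ j | lookup π i ≟ lookup π j
  ...   | yes i≡j | _        = i≡j
  ...   | no _    | yes _    = ⊥-elim distinct
  ...   | no _    | no πi≢πj = ⊥-elim (πi≢πj πi≡πj)

  injective⇒isPerm : Injective _≡_ _≡_ (lookup π) → T (isPerm π)
  injective⇒isPerm inj = allᵇ⁺ (λ i → allᵇ⁺ (distinct i) (allFin n)) (allFin n)
    where
    distinct : ∀ i j → T (⌊ i ≟ j ⌋ ∨ not ⌊ lookup π i ≟ lookup π j ⌋)
    distinct i j with i ≟ j | lookup π i ≟ lookup π j
    ... | yes _  | _         = _
    ... | no _   | no _      = _
    ... | no i≢j | yes πi≡πj = ⊥-elim (i≢j (inj πi≡πj))

Sym-unique : ∀ n → Unique (Sym n)
Sym-unique n = Unique.filter⁺ (T? ∘ isPerm) (allVecs-unique n n)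

∈-Sym⁺ : ∀ {n} {π : Vec (Fin n) n} → Injective _≡_ _≡_ (lookup π) → π ∈ Sym n
∈-Sym⁺ {π = π} inj = ∈-filter⁺ (T? ∘ isPerm) (∈-allVecs π) (injective⇒isPerm π inj)

∈-Sym⁻ : ∀ {n} {π : Vec (Fin n) n} → π ∈ Sym n → Injective _≡_ _≡_ (lookup π)
∈-Sym⁻ {n} {π} π∈ = isPerm⇒injective π (proj₂ (∈-filter⁻ (T? ∘ isPerm) {xs = allVecs n n} π∈))

-- The involution

negate : ∀ {n} → Fin n → Fin n
negate zero    = zero
negate (suc i) = suc (opposite i)

negate-involutive : ∀ {n} → Involutive _≡_ (negate {n})
negate-involutive zero    = refl
negate-involutive (suc i) = cong suc (opposite-involutive i)

count-negate : ∀ {n} (p : Fin n → Bool) → count (p ∘ negate) (allFin n) ≡ count p (allFin n)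
count-negate {n} p = count-involution p negate-involutive (Unique.allFin⁺ n) (λ _ → ∈-allFin _)

dual : ∀ {n} → Vec (Fin n) n → Vec (Fin n) n
dual π = tabulate (opposite ∘ lookup π ∘ negate)

module _ {n : ℕ} (π : Vec (Fin n) n) where

  lookup-dual : ∀ i → lookup (dual π) i ≡ opposite (lookup π (negate i))
  lookup-dual = lookup∘tabulate (opposite ∘ lookup π ∘ negate)

  lookup-dual-negate : ∀ i → lookup (dual π) (negate i) ≡ opposite (lookup π i)
  lookup-dual-negate i = trans (lookup-dual (negate i)) (cong (opposite ∘ lookup π) (negate-involutive i))

  dual-injective : Injective _≡_ _≡_ (lookup π) → Injective _≡_ _≡_ (lookup (dual π))
  dual-injective inj {i} {j} eq = involutive⇒injective negate negate-involutive (inj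
    (involutive⇒injective opposite opposite-involutive (trans (sym (lookup-dual i)) (trans eq (lookup-dual j)))))

dual-involutive : ∀ {n} → Involutive _≡_ (dual {n})
dual-involutive π = trans
  (tabulate-cong (λ i → trans (cong opposite (lookup-dual-negate π i)) (opposite-involutive _)))
  (tabulate∘lookup π)

dual-∈-Sym : ∀ {n} {π : Vec (Fin n) n} → π ∈ Sym n → dual π ∈ Sym n
dual-∈-Sym {π = π} π∈ = ∈-Sym⁺ (dual-injective π (∈-Sym⁻ π∈))

-- Weak excedences

antiExcedence : ∀ {n} → Vec (Fin n) n → Fin n → Bool
antiExcedence π i = toℕ (lookup π i) <ᵇ toℕ i

not-antiExcedence-dual : ∀ {m} (π : Vec (Fin (suc m)) (suc m)) (j : Fin m) →
                         not (antiExcedence (dual π) (negate (suc j))) ≡ antiExcedence π (suc j)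
not-antiExcedence-dual {m} π j = begin
  not (toℕ (lookup (dual π) (negate (suc j))) <ᵇ suc (toℕ (opposite j)))
    ≡⟨ cong₂ (λ a b → not (a <ᵇ suc b))
             (trans (cong toℕ (lookup-dual-negate π (suc j))) (opposite-prop x)) (opposite-prop j) ⟩
  not (m ∸ toℕ x <ᵇ suc (m ∸ suc (toℕ j)))
    ≡⟨ cong (λ b → not (m ∸ toℕ x <ᵇ b)) (sym (+-∸-assoc 1 (toℕ<n j))) ⟩
  not (m ∸ toℕ x <ᵇ m ∸ toℕ j)              ≡⟨ cong not (∸-<ᵇ-flip (s≤s⁻¹ (toℕ<n x))) ⟩
  not (toℕ j <ᵇ toℕ x)                      ≡⟨ not-<ᵇ (toℕ j) (toℕ x) ⟩
  toℕ x <ᵇ suc (toℕ j)                      ∎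
  where
  open ≡-Reasoning
  x = lookup π (suc j)

wex-dual : ∀ {m} (π : Vec (Fin (suc m)) (suc m)) → wex (dual π) + wex π ≡ suc (suc m)
wex-dual {m} π = begin
  wex (dual π) + wex π
    ≡⟨ cong (_+ wex π) (sym (count-negate (not ∘ antiExcedence (dual π)))) ⟩
  count (not ∘ antiExcedence (dual π) ∘ negate) (allFin (suc m)) + wex π
    ≡⟨ cong (_+ wex π) (count-allFin-suc (not ∘ antiExcedence (dual π) ∘ negate)) ⟩
  suc (count (not ∘ antiExcedence (dual π) ∘ negate ∘ suc) (allFin m)) + wex π
    ≡⟨ cong (λ c → suc c + wex π) (count-cong (not-antiExcedence-dual π) (allFin m)) ⟩
  suc (count (antiExcedence π ∘ suc) (allFin m)) + wex π
    ≡⟨ cong (λ c → suc (c + wex π)) (sym (count-allFin-suc (antiExcedence π))) ⟩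
  suc (count (antiExcedence π) (allFin (suc m)) + wex π)
    ≡⟨ cong suc (+-comm _ (wex π)) ⟩
  suc (count (not ∘ antiExcedence π) (allFin (suc m)) + count (antiExcedence π) (allFin (suc m)))
    ≡⟨ cong suc (count-complement (antiExcedence π) (allFin (suc m))) ⟩
  suc (length (allFin (suc m)))
    ≡⟨ cong suc (length-tabulate id) ⟩
  suc (suc m) ∎
  where open ≡-Reasoning

-- Cyclic order

-- clockwise (a ∷ b ∷ c ∷ d ∷ []) unfolds to cyclic₄ (a <ᵇ b) (b <ᵇ c) (c <ᵇ d) (d <ᵇ a),
-- and clockwise (a ∷ b ∷ c ∷ []) to cyclic₃ (a <ᵇ b) (b <ᵇ c) (c <ᵇ a).
cyclic₄ : Bool → Bool → Bool → Bool → Bool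
cyclic₄ p q r s = (p ∧ (q ∧ (r ∧ true))) ∨ ((q ∧ (r ∧ (s ∧ true)))
                ∨ ((r ∧ (s ∧ (p ∧ true))) ∨ ((s ∧ (p ∧ (q ∧ true))) ∨ false)))

cyclic₃ : Bool → Bool → Bool → Bool
cyclic₃ p q r = (p ∧ (q ∧ true)) ∨ ((q ∧ (r ∧ true)) ∨ ((r ∧ (p ∧ true)) ∨ false))

cyclic₄-reverse : ∀ p q r s → cyclic₄ p q r s ≡ cyclic₄ r q p s
cyclic₄-reverse true  q     true  s     = refl
cyclic₄-reverse false q     false s     = refl
cyclic₄-reverse true  true  false true  = refl
cyclic₄-reverse true  true  false false = refl
cyclic₄-reverse true  false false true  = refl
cyclic₄-reverse true  false false false = refl
cyclic₄-reverse false true  true  true  = refl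
cyclic₄-reverse false true  true  false = refl
cyclic₄-reverse false false true  true  = refl
cyclic₄-reverse false false true  false = refl

cyclic₄-true-false : ∀ q r → cyclic₄ true q r false ≡ cyclic₄ r q false true
cyclic₄-true-false true  true  = refl
cyclic₄-true-false true  false = refl
cyclic₄-true-false false true  = refl
cyclic₄-true-false false false = refl

cyclic₄-true : ∀ q r s → cyclic₄ true q r s ≡ cyclic₃ q r s
cyclic₄-true true  true  s     = refl
cyclic₄-true true  false true  = refl
cyclic₄-true true  false false = refl
cyclic₄-true false true  true  = refl
cyclic₄-true false true  false = refl
cyclic₄-true false false s     = refl

cyclic₄-false : ∀ p q s → (T s → T p → T q → ⊥) → cyclic₄ p q false s ≡ false
cyclic₄-false true  true  true  absurd = ⊥-elim (absurd _ _ _)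
cyclic₄-false true  true  false _ = refl
cyclic₄-false true  false true  _ = refl
cyclic₄-false true  false false _ = refl
cyclic₄-false false true  true  _ = refl
cyclic₄-false false true  false _ = refl
cyclic₄-false false false true  _ = refl
cyclic₄-false false false false _ = refl

cyclic₄-false-false : ∀ p r → cyclic₄ p false r false ≡ false
cyclic₄-false-false true  true  = refl
cyclic₄-false-false true  false = refl
cyclic₄-false-false false true  = refl
cyclic₄-false-false false false = refl

reflect : ℕ → ℕ → ℕ
reflect N zero    = zero
reflect N (suc x) = N ∸ suc x

0<ᵇreflect : ∀ {N x} → suc x < N → (0 <ᵇ reflect N (suc x)) ≡ true
0<ᵇreflect 1+x<N = Equivalence.to T-≡ (<⇒<ᵇ (m<n⇒0<n∸m 1+x<N))

-- Reflection fixes 0; the hypotheses keep at most one of the four points there.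
clockwise-reflect : ∀ {N} a b c d → a ≢ d → a < N → suc b < N → suc c < N → d < N →
  clockwise (reflect N a ∷ reflect N (suc b) ∷ reflect N (suc c) ∷ reflect N d ∷ [])
    ≡ clockwise (d ∷ suc c ∷ suc b ∷ a ∷ [])
clockwise-reflect zero b c zero a≢d _ _ _ _ = ⊥-elim (a≢d refl)
clockwise-reflect zero b c (suc d) _ _ b<N c<N d<N
  rewrite 0<ᵇreflect b<N | ∸-<ᵇ-flip {y = suc c} (<⇒≤ b<N) | ∸-<ᵇ-flip {y = suc d} (<⇒≤ c<N) =
  cyclic₄-true-false (c <ᵇ b) (d <ᵇ c)
clockwise-reflect (suc a) b c zero _ a<N b<N c<N _
  rewrite 0<ᵇreflect a<N | ∸-<ᵇ-flip {y = suc b} (<⇒≤ a<N) | ∸-<ᵇ-flip {y = suc c} (<⇒≤ b<N) =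
  sym (cyclic₄-true-false (c <ᵇ b) (b <ᵇ a))
clockwise-reflect (suc a) b c (suc d) _ a<N b<N c<N d<N
  rewrite ∸-<ᵇ-flip {y = suc b} (<⇒≤ a<N) | ∸-<ᵇ-flip {y = suc c} (<⇒≤ b<N)
        | ∸-<ᵇ-flip {y = suc d} (<⇒≤ c<N) | ∸-<ᵇ-flip {y = suc a} (<⇒≤ d<N) =
  cyclic₄-reverse (b <ᵇ a) (c <ᵇ b) (d <ᵇ c) (a <ᵇ d)

-- Alignments

clockwise-interleaved : ∀ a b c d →
  clockwise (2 * a ∷ suc (2 * b) ∷ suc (2 * c) ∷ 2 * d ∷ [])
    ≡ cyclic₄ (a <ᵇ suc b) (b <ᵇ c) (c <ᵇ d) (d <ᵇ a)
clockwise-interleaved a b c d rewrite 2*<ᵇ1+2* a b | 2*<ᵇ2* b c | 1+2*<ᵇ2* c d | 2*<ᵇ2* d a = refl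

cyclic₄-fixed : ∀ a b d → cyclic₄ (a <ᵇ suc b) (b <ᵇ d) (d <ᵇ d) (d <ᵇ a) ≡ false
cyclic₄-fixed a b d rewrite n<ᵇn d = cyclic₄-false _ _ _ no-cycle
  where
  no-cycle : T (d <ᵇ a) → T (a <ᵇ suc b) → T (b <ᵇ d) → ⊥
  no-cycle d<a a<1+b b<d = <-irrefl refl
    (<-trans (<-≤-trans (<ᵇ⇒< d a d<a) (s≤s⁻¹ (<ᵇ⇒< a (suc b) a<1+b))) (<ᵇ⇒< b d b<d))

-- alignedOrd π i j is alignedᴺ (toℕ i) (toℕ (lookup π i)) (toℕ (lookup π j)) (toℕ j).
alignedᴺ : ℕ → ℕ → ℕ → ℕ → Bool
alignedᴺ a b c d = (not (a ≡ᵇ b) ∧ not (d ≡ᵇ c) ∧ clockwise (a ∷ b ∷ c ∷ d ∷ []))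
                 ∨ ((a ≡ᵇ b) ∧ not (d ≡ᵇ c) ∧ clockwise (a ∷ c ∷ d ∷ []))

alignedᴺ-cyclic₄ : ∀ a b c d → alignedᴺ a b c d ≡ cyclic₄ (a <ᵇ suc b) (b <ᵇ c) (c <ᵇ d) (d <ᵇ a)
alignedᴺ-cyclic₄ a b c d with a ≡ᵇ b in a≟b | d ≡ᵇ c in d≟c
... | false | false rewrite m≢n⇒m<ᵇ1+n (λ a≡b → subst T a≟b (≡⇒≡ᵇ a b a≡b)) = ∨-identityʳ _
... | true  | false with refl ← ≡ᵇ⇒≡ a b (subst T (sym a≟b) _) rewrite n<ᵇ1+n a =
  sym (cyclic₄-true (a <ᵇ c) (c <ᵇ d) (d <ᵇ a))
... | false | true  with refl ← ≡ᵇ⇒≡ d c (subst T (sym d≟c) _) = sym (cyclic₄-fixed a b d)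
... | true  | true  with refl ← ≡ᵇ⇒≡ d c (subst T (sym d≟c) _) = sym (cyclic₄-fixed a b d)

alignedᴺ-irrefl : ∀ a b → alignedᴺ a b b a ≡ false
alignedᴺ-irrefl a b rewrite alignedᴺ-cyclic₄ a b b a | n<ᵇn a | n<ᵇn b =
  cyclic₄-false-false (a <ᵇ suc b) (b <ᵇ a)

alignedOrd-interleaved : ∀ {n} (π : Vec (Fin n) n) i j → alignedOrd π i j ≡
  clockwise (2 * toℕ i ∷ suc (2 * toℕ (lookup π i)) ∷ suc (2 * toℕ (lookup π j)) ∷ 2 * toℕ j ∷ [])
alignedOrd-interleaved π i j = trans (alignedᴺ-cyclic₄ a b c d) (sym (clockwise-interleaved a b c d))
  where
  a = toℕ i
  b = toℕ (lookup π i)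
  c = toℕ (lookup π j)
  d = toℕ j

2*negate : ∀ {n} (i : Fin n) → 2 * toℕ (negate i) ≡ reflect (2 * n) (2 * toℕ i)
2*negate zero = refl
2*negate {suc m} (suc i) = begin
  2 * suc (toℕ (opposite i))     ≡⟨ cong (λ x → 2 * suc x) (opposite-prop i) ⟩
  2 * suc (m ∸ suc (toℕ i))      ≡⟨ cong (2 *_) (sym (+-∸-assoc 1 (toℕ<n i))) ⟩
  2 * (suc m ∸ suc (toℕ i))      ≡⟨ *-distribˡ-∸ 2 (suc m) (suc (toℕ i)) ⟩
  2 * suc m ∸ 2 * suc (toℕ i)    ∎
  where open ≡-Reasoning

1+2*opposite : ∀ {n} (u : Fin n) → suc (2 * toℕ (opposite u)) ≡ reflect (2 * n) (suc (2 * toℕ u))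
1+2*opposite {n} u = begin
  suc (2 * toℕ (opposite u))    ≡⟨ cong (λ x → suc (2 * x)) (opposite-prop u) ⟩
  suc (2 * (n ∸ suc b))         ≡⟨ cong suc (*-distribˡ-∸ 2 n (suc b)) ⟩
  suc (2 * n ∸ 2 * suc b)       ≡⟨ sym (+-∸-assoc 1 (*-monoʳ-≤ 2 (toℕ<n u))) ⟩
  suc (2 * n) ∸ 2 * suc b       ≡⟨ cong (suc (2 * n) ∸_) (*-suc 2 b) ⟩
  2 * n ∸ suc (2 * b)           ∎
  where
  open ≡-Reasoning
  b = toℕ u

alignedOrd-dual : ∀ {n} (π : Vec (Fin n) n) {i j} → i ≢ j →
                  alignedOrd (dual π) (negate i) (negate j) ≡ alignedOrd π j i
alignedOrd-dual {n} π {i} {j} i≢j = begin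
  alignedOrd (dual π) (negate i) (negate j)
    ≡⟨ alignedOrd-interleaved (dual π) (negate i) (negate j) ⟩
  cw (2 * toℕ (negate i)) (suc (2 * toℕ (lookup (dual π) (negate i))))
     (suc (2 * toℕ (lookup (dual π) (negate j)))) (2 * toℕ (negate j))
    ≡⟨ cong₂ (λ x y → cw (2 * toℕ (negate i)) (suc (2 * toℕ x)) (suc (2 * toℕ y)) (2 * toℕ (negate j)))
             (lookup-dual-negate π i) (lookup-dual-negate π j) ⟩
  cw (2 * toℕ (negate i)) b′ c′ (2 * toℕ (negate j))
    ≡⟨ cong₂ (λ x y → cw x b′ c′ y) (2*negate i) (2*negate j) ⟩
  cw (reflect N (2 * a)) b′ c′ (reflect N (2 * d))
    ≡⟨ cong₂ (λ x y → cw (reflect N (2 * a)) x y (reflect N (2 * d))) (1+2*opposite u) (1+2*opposite v) ⟩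
  cw (reflect N (2 * a)) (reflect N (suc (2 * b))) (reflect N (suc (2 * c))) (reflect N (2 * d))
    ≡⟨ clockwise-reflect (2 * a) (2 * b) (2 * c) (2 * d) 2a≢2d
         (*-monoʳ-< 2 (toℕ<n i)) (1+2*< u) (1+2*< v) (*-monoʳ-< 2 (toℕ<n j)) ⟩
  cw (2 * d) (suc (2 * c)) (suc (2 * b)) (2 * a)
    ≡⟨ sym (alignedOrd-interleaved π j i) ⟩
  alignedOrd π j i ∎
  where
  open ≡-Reasoning
  cw : ℕ → ℕ → ℕ → ℕ → Bool
  cw w x y z = clockwise (w ∷ x ∷ y ∷ z ∷ [])
  N = 2 * n
  u = lookup π i
  v = lookup π j
  a = toℕ i
  b = toℕ u
  c = toℕ v
  d = toℕ j
  b′ = suc (2 * toℕ (opposite u))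
  c′ = suc (2 * toℕ (opposite v))
  2a≢2d : 2 * a ≢ 2 * d
  2a≢2d = i≢j ∘ toℕ-injective ∘ *-cancelˡ-≡ a d 2
  1+2*< : (x : Fin n) → suc (2 * toℕ x) < N
  1+2*< x = subst (_≤ N) (*-suc 2 (toℕ x)) (*-monoʳ-≤ 2 (toℕ<n x))

aligned : ∀ {n} → Vec (Fin n) n → Fin n → Fin n → Bool
aligned π i j = alignedOrd π i j ∨ alignedOrd π j i

aligned-irrefl : ∀ {n} (π : Vec (Fin n) n) i → aligned π i i ≡ false
aligned-irrefl π i = cong₂ _∨_ irrefl irrefl
  where irrefl = alignedᴺ-irrefl (toℕ i) (toℕ (lookup π i))

aligned-dual : ∀ {n} (π : Vec (Fin n) n) i j → aligned (dual π) (negate i) (negate j) ≡ aligned π i j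
aligned-dual π i j with i ≟ j
... | yes refl = trans (aligned-irrefl (dual π) (negate i)) (sym (aligned-irrefl π i))
... | no i≢j   = trans (cong₂ _∨_ (alignedOrd-dual π i≢j) (alignedOrd-dual π (i≢j ∘ sym)))
                       (∨-comm (alignedOrd π j i) (alignedOrd π i j))

alignedBelow : ∀ {n} → Vec (Fin n) n → Fin n × Fin n → Bool
alignedBelow π (i , j) = (toℕ i <ᵇ toℕ j) ∧ aligned π i j

al-alignedBelow : ∀ {n} (π : Vec (Fin n) n) → al π ≡ count (alignedBelow π) (allPairs n)
al-alignedBelow {n} π =
  length-concatMap-filterᵇ (λ i j → (toℕ i <ᵇ toℕ j) ∧ aligned π i j) (allFin n) (allFin n)

∨-split : ∀ {p q : Bool} x y → (T p → T q → ⊥) → (p ≡ false → q ≡ false → x ∨ y ≡ false) →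
          x ∨ y ≡ (p ∧ (x ∨ y)) ∨ (q ∧ (y ∨ x))
∨-split {true}  {true}  x y disjoint _ = ⊥-elim (disjoint _ _)
∨-split {true}  {false} x y _ _        = sym (∨-identityʳ _)
∨-split {false} {true}  x y _ _        = ∨-comm x y
∨-split {false} {false} x y _ neither  = neither refl refl

aligned-split : ∀ {n} (π : Vec (Fin n) n) i j →
                aligned π i j ≡ alignedBelow π (i , j) ∨ alignedBelow π (j , i)
aligned-split π i j = ∨-split {toℕ i <ᵇ toℕ j} {toℕ j <ᵇ toℕ i} (alignedOrd π i j) (alignedOrd π j i)
  (λ i<j j<i → <-asym (<ᵇ⇒< (toℕ i) (toℕ j) i<j) (<ᵇ⇒< (toℕ j) (toℕ i) j<i))
  (λ i≮j j≮i → trans (cong (aligned π i) (sym (toℕ-injective (≤-antisym (≮⇒≥ (≮ j≮i)) (≮⇒≥ (≮ i≮j))))))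
                     (aligned-irrefl π i))
  where
  ≮ : ∀ {m n} → (m <ᵇ n) ≡ false → ¬ m < n
  ≮ m≮n = subst T m≮n ∘ <⇒<ᵇ

count-aligned : ∀ {n} (π : Vec (Fin n) n) → count (uncurry (aligned π)) (allPairs n) ≡ al π + al π
count-aligned {n} π = begin
  count (uncurry (aligned π)) (allPairs n)
    ≡⟨ count-cong (λ (i , j) → aligned-split π i j) (allPairs n) ⟩
  count (λ x → alignedBelow π x ∨ alignedBelow π (swap x)) (allPairs n)
    ≡⟨ count-∨ (alignedBelow π) (alignedBelow π ∘ swap) below-asym (allPairs n) ⟩
  count (alignedBelow π) (allPairs n) + count (alignedBelow π ∘ swap) (allPairs n)
    ≡⟨ cong (_+_ (count (alignedBelow π) (allPairs n)))
            (count-allPairs-involution (alignedBelow π) {swap} (λ _ → refl)) ⟩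
  count (alignedBelow π) (allPairs n) + count (alignedBelow π) (allPairs n)
    ≡⟨ sym (cong₂ _+_ (al-alignedBelow π) (al-alignedBelow π)) ⟩
  al π + al π ∎
  where
  open ≡-Reasoning
  below-asym : ∀ x → T (alignedBelow π x) → T (alignedBelow π (swap x)) → ⊥
  below-asym (i , j) i<j j<i = <-asym (<ᵇ⇒< (toℕ i) (toℕ j) (proj₁ (Equivalence.to T-∧ i<j)))
                                      (<ᵇ⇒< (toℕ j) (toℕ i) (proj₁ (Equivalence.to T-∧ j<i)))

-- negate does not preserve i < j, so the unordered count al is compared through the ordered one.
al-dual : ∀ {n} (π : Vec (Fin n) n) → al (dual π) ≡ al π
al-dual {n} π = m+m≡n+n⇒m≡n (begin
  al (dual π) + al (dual π)
    ≡⟨ sym (count-aligned (dual π)) ⟩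
  count (uncurry (aligned (dual π))) (allPairs n)
    ≡⟨ sym (count-allPairs-involution _ {Product.map negate negate} negate×negate-involutive) ⟩
  count (uncurry (aligned (dual π)) ∘ Product.map negate negate) (allPairs n)
    ≡⟨ count-cong (λ (i , j) → aligned-dual π i j) (allPairs n) ⟩
  count (uncurry (aligned π)) (allPairs n)
    ≡⟨ count-aligned π ⟩
  al π + al π ∎)
  where
  open ≡-Reasoning
  negate×negate-involutive : Involutive _≡_ (Product.map (negate {n}) negate)
  negate×negate-involutive (i , j) = cong₂ _,_ (negate-involutive i) (negate-involutive j)

-- The exponent

degree-shift-symmetric : ∀ t m (a : ℤ) →
  (+ suc t - + (suc t + m)) ℤ.+ (+ (suc t * m) - a) ≡ (+ suc m - + (suc t + m)) ℤ.+ (+ (suc m * t) - a)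
degree-shift-symmetric t m a
  rewrite ℤ.pos-+ (suc t) m | ℤ.pos-* (suc t) m | ℤ.pos-* (suc m) t | ℤ.pos-+ 1 t | ℤ.pos-+ 1 m =
  solve 3 (λ t m a → ((con (+ 1) :+ t) :- ((con (+ 1) :+ t) :+ m)) :+ (((con (+ 1) :+ t) :* m) :- a)
                  := ((con (+ 1) :+ m) :- ((con (+ 1) :+ t) :+ m)) :+ (((con (+ 1) :+ m) :* t) :- a))
          refl (+ t) (+ m) a
  where open +-*-Solver

hatExp-dual : ∀ k n (π σ : Vec (Fin n) n) → 1 ≤ k → k ≤ n → al π ≡ al σ →
              hatExp k n π ≡ hatExp (n + 1 ∸ k) n σ
hatExp-dual (suc t) _ π σ _ k≤n al≡ with m , refl ← m≤n⇒∃[o]m+o≡n k≤n = begin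
  (+ k - + n) ℤ.+ (+ (k * (n ∸ k)) - + al π)
    ≡⟨ cong₂ (λ x y → (+ k - + n) ℤ.+ (+ (k * x) - + y)) (m+n∸m≡n k m) al≡ ⟩
  (+ k - + n) ℤ.+ (+ (k * m) - + al σ)
    ≡⟨ degree-shift-symmetric t m (+ al σ) ⟩
  (+ suc m - + n) ℤ.+ (+ (suc m * t) - + al σ)
    ≡⟨ sym (cong₂ (λ x y → (+ x - + n) ℤ.+ (+ (x * y) - + al σ)) n+1∸k≡1+m n∸[1+m]≡t) ⟩
  (+ (n + 1 ∸ k) - + n) ℤ.+ (+ ((n + 1 ∸ k) * (n ∸ (n + 1 ∸ k))) - + al σ) ∎
  where
  open ≡-Reasoning
  k = suc t
  n = k + m
  n+1∸k≡1+m : n + 1 ∸ k ≡ suc m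
  n+1∸k≡1+m = trans (cong (_∸ k) (+-assoc k m 1)) (trans (m+n∸m≡n k (m + 1)) (+-comm m 1))
  n∸[1+m]≡t : n ∸ (n + 1 ∸ k) ≡ t
  n∸[1+m]≡t = trans (cong (n ∸_) n+1∸k≡1+m)
                    (trans (cong (_∸ suc m) (sym (+-suc t m))) (m+n∸n≡m t (suc m)))

proposition5p4 : (k n : ℕ) → 1 ≤ k → k ≤ n →
    (e : ℤ) → hatE-coeff k n e ≡ hatE-coeff (n + 1 ∸ k) n e
proposition5p4 _ zero    (s≤s _) () _
proposition5p4 k (suc m) 1≤k k≤n e = begin
  count (P k) (Sym n)            ≡⟨ sym (count-involution (P k) dual-involutive (Sym-unique n) dual-∈-Sym) ⟩
  count (P k ∘ dual) (Sym n)     ≡⟨ count-cong dual-exchanges-P (Sym n) ⟩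
  count (P (n + 1 ∸ k)) (Sym n)  ∎
  where
  open ≡-Reasoning
  n = suc m
  P : ℕ → Vec (Fin n) n → Bool
  P j π = (wex π ≡ᵇ j) ∧ ⌊ hatExp j n π ℤ.≟ e ⌋
  dual-exchanges-P : ∀ π → P k (dual π) ≡ P (n + 1 ∸ k) π
  dual-exchanges-P π = cong₂ _∧_
    (≡ᵇ-complement (wex (dual π)) (wex π) k (trans (wex-dual π) (+-comm 1 n)) (m≤n⇒m≤n+o 1 k≤n))
    (cong (λ x → ⌊ x ℤ.≟ e ⌋) (hatExp-dual k n (dual π) π 1≤k k≤n (al-dual π)))
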